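{- Let $R$ be a ring, $\tau\in\mathbf{M}_{\mathrm{stab}}(R)$ and $a\in\mathbf{G}_\tau(R)$. Assume that $\mathbf{X}_{\tau,a}$ is doubly-tangential at $1$ over $R$. Then for all $u_1,u_2\in\mathbf{M}_{H,\tau_H}(R)$, $$2\bigl(\mu(u_1u_2)-\mu(u_1)\mu(u_2)\bigr)=0,$$ where $\mu:\mathbf{M}_{H,\tau_H}(R)\to\mathbf{M}_\tau(R)$ is $\mu(u)=[e^*\bullet]^{ -1}(e^*aua^{ -1})$.
   Context: Rings are commutative with $1$. Let $\mathbf{V}$ be a free $\mathbb{Z}$-module of finite rank, $\mathbf{V}^*=\mathrm{Hom}(\mathbf{V},\mathbb{Z})$; fix $e\in\mathbf{V}$, $e^*\in\mathbf{V}^*$ with $e^*(e)=1$. For a ring $R$: $\mathbf{V}(R)=\mathbf{V}\otimes R$, $\mathbf{V}^*(R)=\mathrm{Hom}_R(\mathbf{V}(R),R)$, $\mathbf{M}(R)=\mathrm{End}_R(\mathbf{V}(R))$, $\mathbf{G}(R)=\mathrm{Aut}_R(\mathbf{V}(R))$. Juxtaposition: $xv=x(v)$, $\ell x=\ell\circ x$, $v\ell=(w\mapsto\ell(w)v)$. $\mathbf{V}_H(R)=\{v:e^*v=0\}$, $1_H=1-ee^*$, $\mathbf{M}_H(R)=\mathrm{End}_R(\mathbf{V}_H(R))$ viewed inside $\mathbf{M}(R)$ by extending by $0$ on $Re$, $\mathbf{H}(R)=\mathrm{Aut}_R(\mathbf{V}_H(R))$ acting trivially on $Re$, $\tau_H=1_H\tau1_H$.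 For an $R$-algebra $R'$: $\mathbf{G}_\tau(R'),\mathbf{M}_\tau(R')$ = centralizers of $\tau$ in $\mathbf{G}(R'),\mathbf{M}(R')$; $\mathbf{H}_{\tau_H}(R'),\mathbf{M}_{H,\tau_H}(R')$ = centralizers of $\tau_H$ in $\mathbf{H}(R'),\mathbf{M}_H(R')$. $\tau$ is stable if $R[\tau]e=\mathbf{V}(R)$ and $e^*R[\tau]=\mathbf{V}^*(R)$; $\mathbf{M}_{\mathrm{stab}}(R)$ = stable elements. For stable $\tau$ the map $\mathbf{M}_\tau(R)\to\mathbf{V}^*(R)$, $x\mapsto e^*x$, is a bijection with inverse $[e^*\bullet]^{ -1}$. $\mathbf{X}_{\tau,a}(R')=\{y\in\mathbf{H}_{\tau_H}(R'):ay\in\mathbf{H}(R')\mathbf{G}_\tau(R')\}$. With $R''=R[\varepsilon_1,\varepsilon_2]/(\varepsilon_1^2,\varepsilon_2^2)$, $\mathbf{X}_{\tau,a}$ is doubly-tangential at $y\in\mathbf{X}_{\tau,a}(R)$ over $R$ if every $y''\in\mathbf{H}_{\tau_H}(R'')$ reducing to $y$ (via $\varepsilon_1,\varepsilon_2\mapsto0$) lies in $\mathbf{X}_{\tau,a}(R'')$. -}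

module Defs where

open import Level using (_⊔_)
open import Algebra.Bundles using (CommutativeRing)
open import Data.Nat using (ℕ; zero; suc)
open import Data.Fin using (Fin; zero; suc)
open import Data.Fin.Properties using (_≟_)
open import Data.Integer as ℤ using (ℤ; +_; -[1+_])
open import Data.List using (List; []; _∷_)
open import Data.Product using (Σ; ∃; _×_; _,_)
open import Relation.Nullary using (yes; no)
open import Function using (_∘_)

sumℤ : ∀ {n} → (Fin n → ℤ) → ℤ
sumℤ {zero} f = + 0
sumℤ {suc n} f = f zero ℤ.+ sumℤ (f ∘ suc)

dotℤ : ∀ {n} → (Fin n → ℤ) → (Fin n → ℤ) → ℤ
dotℤ l v = sumℤ (λ i → l i ℤ.* v i)

-- Everything over a commutative ring R, with V(R) = R^n, and fixed e, e*
-- coming from ℤ^n (base change ℤ → R).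
module Over {c ℓ} (R : CommutativeRing c ℓ) (n : ℕ) (e⁰ e*⁰ : Fin n → ℤ) where
  open CommutativeRing R hiding (zero)

  ιℕ : ℕ → Carrier
  ιℕ zero = 0#
  ιℕ (suc k) = 1# + ιℕ k

  ι : ℤ → Carrier
  ι (+ k) = ιℕ k
  ι -[1+ k ] = - ιℕ (suc k)

  sumF : ∀ {m} → (Fin m → Carrier) → Carrier
  sumF {zero} f = 0#
  sumF {suc m} f = f zero + sumF (f ∘ suc)

  -- V(R), V*(R) (as coordinate row vectors), M(R) = End(V(R)) as matrices
  Vec : Set c
  Vec = Fin n → Carrier

  Mat : Set c
  Mat = Fin n → Fin n → Carrier

  e : Vec
  e = ι ∘ e⁰

  e* : Vec
  e* = ι ∘ e*⁰

  _≈V_ : Vec → Vec → Set ℓ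
  v ≈V w = ∀ i → v i ≈ w i

  _≈M_ : Mat → Mat → Set ℓ
  A ≈M B = ∀ i j → A i j ≈ B i j

  0V : Vec
  0V _ = 0#

  0M : Mat
  0M _ _ = 0#

  𝟙 : Mat
  𝟙 i j with i ≟ j
  ... | yes _ = 1#
  ... | no _ = 0#

  _⊕_ : Mat → Mat → Mat
  (A ⊕ B) i j = A i j + B i j

  _⊖_ : Mat → Mat → Mat
  (A ⊖ B) i j = A i j - B i j

  _⊗_ : Mat → Mat → Mat
  (A ⊗ B) i j = sumF (λ k → A i k * B k j)

  _•_ : Carrier → Mat → Mat
  (r • A) i j = r * A i j

  app : Mat → Vec → Vec
  app A v i = sumF (λ k → A i k * v k)

  capp : Vec → Mat → Vec
  capp l A j = sumF (λ k → l k * A k j)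

  outer : Vec → Vec → Mat
  outer v l i j = v i * l j

  infixl 6 _⊕_ _⊖_
  infixl 7 _⊗_
  infix 4 _≈M_ _≈V_

  1H : Mat
  1H = 𝟙 ⊖ outer e e*

  _H : Mat → Mat
  τ H = 1H ⊗ τ ⊗ 1H

  -- p(τ) for p ∈ R[X] given by coefficient list (Horner)
  polyM : List Carrier → Mat → Mat
  polyM [] τ = 0M
  polyM (r ∷ p) τ = (r • 𝟙) ⊕ τ ⊗ polyM p τ

  Stable : Mat → Set (c ⊔ ℓ)
  Stable τ = (∀ (v : Vec) → ∃ λ (p : List Carrier) → app (polyM p τ) e ≈V v)
           × (∀ (l : Vec) → ∃ λ (p : List Carrier) → capp e* (polyM p τ) ≈V l)

  Commute : Mat → Mat → Set ℓ
  Commute x y = x ⊗ y ≈M y ⊗ x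

  Inverse : Mat → Mat → Set ℓ
  Inverse x x' = (x ⊗ x' ≈M 𝟙) × (x' ⊗ x ≈M 𝟙)

  -- u ∈ M_H(R): u e = 0 and e* u = 0 (endomorphism of V_H extended by 0 on Re)
  InMH : Mat → Set ℓ
  InMH u = (app u e ≈V 0V) × (capp e* u ≈V 0V)

  InMHτ : Mat → Mat → Set ℓ
  InMHτ τ u = InMH u × Commute u (τ H)

  -- R'' = R[ε₁,ε₂]/(ε₁²,ε₂²); a matrix over R'' is
  -- m0 + ε₁ m1 + ε₂ m2 + ε₁ε₂ m12 with mᵢ matrices over R.
  record Mat'' : Set c where
    constructor mk''
    field
      m0 m1 m2 m12 : Mat
  open Mat'' public

  record Vec'' : Set c where
    constructor mkV''
    field
      v0 v1 v2 v12 : Vec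
  open Vec'' public

  infix 4 _≈''_ _≈V''_
  infixl 7 _⊗''_

  _≈''_ : Mat'' → Mat'' → Set ℓ
  A ≈'' B = (m0 A ≈M m0 B) × (m1 A ≈M m1 B) × (m2 A ≈M m2 B) × (m12 A ≈M m12 B)

  _≈V''_ : Vec'' → Vec'' → Set ℓ
  v ≈V'' w = (v0 v ≈V v0 w) × (v1 v ≈V v1 w) × (v2 v ≈V v2 w) × (v12 v ≈V v12 w)

  const'' : Mat → Mat''
  const'' A = mk'' A 0M 0M 0M

  constV'' : Vec → Vec''
  constV'' v = mkV'' v 0V 0V 0V

  𝟙'' : Mat''
  𝟙'' = const'' 𝟙

  _⊗''_ : Mat'' → Mat'' → Mat''
  A ⊗'' B = mk'' (m0 A ⊗ m0 B)
                 (m0 A ⊗ m1 B ⊕ m1 A ⊗ m0 B)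
                 (m0 A ⊗ m2 B ⊕ m2 A ⊗ m0 B)
                 (m0 A ⊗ m12 B ⊕ m1 A ⊗ m2 B ⊕ m2 A ⊗ m1 B ⊕ m12 A ⊗ m0 B)

  app'' : Mat'' → Vec → Vec''
  app'' A v = mkV'' (app (m0 A) v) (app (m1 A) v) (app (m2 A) v) (app (m12 A) v)

  capp'' : Vec → Mat'' → Vec''
  capp'' l A = mkV'' (capp l (m0 A)) (capp l (m1 A)) (capp l (m2 A)) (capp l (m12 A))

  Commute'' : Mat'' → Mat'' → Set ℓ
  Commute'' x y = (x ⊗'' y) ≈'' (y ⊗'' x)

  InG'' : Mat'' → Set (c ⊔ ℓ)
  InG'' x = ∃ λ (x' : Mat'') → ((x ⊗'' x') ≈'' 𝟙'') × ((x' ⊗'' x) ≈'' 𝟙'')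

  -- x ∈ H(R''): automorphism of V_H(R'') acting trivially on R''e, i.e.
  -- x ∈ G(R'') with x e = e and e* x = e*
  InH'' : Mat'' → Set (c ⊔ ℓ)
  InH'' x = InG'' x × (app'' x e ≈V'' constV'' e) × (capp'' e* x ≈V'' constV'' e*)

  InHτ'' : Mat → Mat'' → Set (c ⊔ ℓ)
  InHτ'' τ y = InH'' y × Commute'' y (const'' (τ H))

  InX'' : Mat → Mat → Mat'' → Set (c ⊔ ℓ)
  InX'' τ a y = InHτ'' τ y ×
    (∃ λ (h : Mat'') → ∃ λ (g : Mat'') →
       InH'' h × InG'' g × Commute'' g (const'' τ) × ((const'' a ⊗'' y) ≈'' (h ⊗'' g)))

  DoublyTangentialAt1 : Mat → Mat → Set (c ⊔ ℓ)
  DoublyTangentialAt1 τ a =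
    ∀ (y : Mat'') → InHτ'' τ y → m0 y ≈M 𝟙 → InX'' τ a y

{-# OPTIONS --safe #-}
module Submission where

open import Defs
open import Algebra.Bundles using (CommutativeRing; Ring)
import Algebra.Construct.Pointwise as Pointwise
import Algebra.Properties.RingWithoutOne as RingWithoutOneProperties
import Algebra.Properties.Ring as RingProperties
open import Level using (_⊔_)
open import Data.Nat as ℕ using (ℕ; zero; suc)
open import Data.Fin using (Fin; zero; suc)
open import Data.Fin.Properties using (_≟_; suc-injective)
open import Data.Integer as ℤ using (ℤ; +_; -[1+_])
import Data.Integer.Properties as ℤ
open import Data.Sign as Sign using (Sign)
open import Data.List using (List; []; _∷_)
open import Data.Maybe using (nothing)
open import Data.Product using (∃; _×_; _,_; proj₁; proj₂)
open import Relation.Nullary using (yes; no; contradiction)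
open import Relation.Binary.PropositionalEquality as ≡ using (_≡_; _≢_)
import Relation.Binary.Reasoning.Setoid as SetoidReasoning
open import Tactic.RingSolver.Core.AlmostCommutativeRing using (fromCommutativeRing)
import Tactic.RingSolver.NonReflective as Solver

-- Double tangency applied to y = 1 + ε₁u₁ + ε₂u₂ ∈ H_{τ_H}(R'') gives a y = h g with
-- h ∈ H(R'') and g ∈ G_τ(R''). Stability of τ makes x ↦ e* x injective and x ↦ x e faithful
-- on M_τ(R), so comparing the coefficients of 1, εᵢ and ε₁ε₂ forces g₀ = a, h₀ = 1,
-- gᵢ = μ(uᵢ) a, hᵢ = a uᵢ a⁻¹ − μ(uᵢ) and g₁₂ = 0. Then hᵢ e = 0 says a u a⁻¹ e = μ(u) e,
-- and the ε₁ε₂-coefficient applied to a⁻¹ e gives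
--   (a u₁ a⁻¹ − μ(u₁)) μ(u₂) e + (a u₂ a⁻¹ − μ(u₂)) μ(u₁) e = 0.
-- M_τ(R) and M_{H,τ_H}(R) are commutative, being centralisers of an operator with a cyclic
-- vector (e for τ on V, 1_H τ e for τ_H on V_H), so this reads 2 (μ(u₁u₂) − μ(u₁) μ(u₂)) e = 0,
-- and faithfulness gives the claim.

module OverProperties {c ℓ} (R : CommutativeRing c ℓ) (n : ℕ) (e⁰ e*⁰ : Fin n → ℤ) where
  open Over R n e⁰ e*⁰
  open CommutativeRing R hiding (zero)
  open Solver (fromCommutativeRing R (λ _ → nothing)) using (solve; _⊜_; Κ)
    renaming (_⊕_ to _:+_; _⊗_ to _:*_)
  open RingProperties ring using (-‿+-comm; -‿involutive; -1*x≈-x; //-rightDividesʳ)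

  sumF-cong : ∀ {m} {f g : Fin m → Carrier} → (∀ i → f i ≈ g i) → sumF f ≈ sumF g
  sumF-cong {zero}  f≈g = refl
  sumF-cong {suc m} f≈g = +-cong (f≈g zero) (sumF-cong (λ i → f≈g (suc i)))

  sumF-zero : ∀ {m} → sumF {m} (λ _ → 0#) ≈ 0#
  sumF-zero {zero}  = refl
  sumF-zero {suc m} = trans (+-identityˡ _) (sumF-zero {m})

  sumF-distrib-+ : ∀ {m} (f g : Fin m → Carrier) →
                   sumF (λ i → f i + g i) ≈ sumF f + sumF g
  sumF-distrib-+ {zero}  f g = sym (+-identityʳ 0#)
  sumF-distrib-+ {suc m} f g =
    trans (+-cong refl (sumF-distrib-+ (λ i → f (suc i)) (λ i → g (suc i))))
          (interchange _ _ _ _)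
    where
    interchange : ∀ a b c d → (a + b) + (c + d) ≈ (a + c) + (b + d)
    interchange = solve 4 (λ a b c d → ((a :+ b) :+ (c :+ d)) ⊜ ((a :+ c) :+ (b :+ d))) refl

  *-distribˡ-sumF : ∀ {m} r (f : Fin m → Carrier) → r * sumF f ≈ sumF (λ i → r * f i)
  *-distribˡ-sumF {zero}  r f = zeroʳ r
  *-distribˡ-sumF {suc m} r f =
    trans (distribˡ r _ _) (+-cong refl (*-distribˡ-sumF r (λ i → f (suc i))))

  *-distribʳ-sumF : ∀ {m} r (f : Fin m → Carrier) → sumF f * r ≈ sumF (λ i → f i * r)
  *-distribʳ-sumF r f =
    trans (*-comm _ r) (trans (*-distribˡ-sumF r f) (sumF-cong (λ i → *-comm r (f i))))

  sumF-comm : ∀ {m k} (f : Fin m → Fin k → Carrier) →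
              sumF (λ i → sumF (f i)) ≈ sumF (λ j → sumF (λ i → f i j))
  sumF-comm {zero}  {k} f = sym (sumF-zero {k})
  sumF-comm {suc m} f =
    trans (+-cong refl (sumF-comm (λ i → f (suc i)))) (sym (sumF-distrib-+ (f zero) _))

  sumF-single : ∀ {m} (i : Fin m) (f : Fin m → Carrier) →
                (∀ k → k ≢ i → f k ≈ 0#) → sumF f ≈ f i
  sumF-single {suc m} zero f f≈0 =
    trans (+-cong refl (trans (sumF-cong (λ k → f≈0 (suc k) λ ())) (sumF-zero {m})))
          (+-identityʳ _)
  sumF-single {suc m} (suc i) f f≈0 =
    trans (+-cong (f≈0 zero λ ()) (sumF-single i (λ k → f (suc k))
                                     (λ k k≢i → f≈0 (suc k) (λ eq → k≢i (suc-injective eq)))))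
          (+-identityˡ _)

  𝟙-diagonal : ∀ i → 𝟙 i i ≡ 1#
  𝟙-diagonal i with i ≟ i
  ... | yes _  = ≡.refl
  ... | no i≢i = contradiction ≡.refl i≢i

  𝟙-offDiagonal : ∀ {i j} → i ≢ j → 𝟙 i j ≡ 0#
  𝟙-offDiagonal {i} {j} i≢j with i ≟ j
  ... | yes i≡j = contradiction i≡j i≢j
  ... | no _    = ≡.refl

  sumF-𝟙ˡ : ∀ i (f : Vec) → sumF (λ k → 𝟙 i k * f k) ≈ f i
  sumF-𝟙ˡ i f = trans (sumF-single i _ (λ k k≢i →
                         trans (*-congʳ (reflexive (𝟙-offDiagonal (≡.≢-sym k≢i)))) (zeroˡ _)))
                       (trans (*-congʳ (reflexive (𝟙-diagonal i))) (*-identityˡ _))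

  sumF-𝟙ʳ : ∀ j (f : Vec) → sumF (λ k → f k * 𝟙 k j) ≈ f j
  sumF-𝟙ʳ j f = trans (sumF-single j _ (λ k k≢j →
                         trans (*-congˡ (reflexive (𝟙-offDiagonal k≢j))) (zeroʳ _)))
                       (trans (*-congˡ (reflexive (𝟙-diagonal j))) (*-identityʳ _))

  ιℕ-+ : ∀ m k → ιℕ (m ℕ.+ k) ≈ ιℕ m + ιℕ k
  ιℕ-+ zero    k = sym (+-identityˡ _)
  ιℕ-+ (suc m) k = trans (+-congˡ (ιℕ-+ m k)) (sym (+-assoc 1# _ _))

  ιℕ-* : ∀ m k → ιℕ (m ℕ.* k) ≈ ιℕ m * ιℕ k
  ιℕ-* zero    k = sym (zeroˡ _)
  ιℕ-* (suc m) k = trans (ιℕ-+ k (m ℕ.* k))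
    (trans (+-cong (sym (*-identityˡ _)) (ιℕ-* m k)) (sym (distribʳ _ 1# _)))

  ι-⊖ : ∀ m k → ι (m ℤ.⊖ k) ≈ ιℕ m - ιℕ k
  ι-⊖ m k = trans (sym (//-rightDividesʳ (ιℕ k) _)) (+-congʳ (ι-⊖-+ m k))
    where
    ι-⊖-+ : ∀ m k → ι (m ℤ.⊖ k) + ιℕ k ≈ ιℕ m
    ι-⊖-+ m       zero    = +-identityʳ _
    ι-⊖-+ zero    (suc k) = -‿inverseˡ _
    ι-⊖-+ (suc m) (suc k) rewrite ℤ.[1+m]⊖[1+n]≡m⊖n m k =
      trans (shift _ _) (+-congˡ (ι-⊖-+ m k))
      where
      shift : ∀ x y → x + (1# + y) ≈ 1# + (x + y)
      shift = solve 2 (λ x y → (x :+ (Κ 1# :+ y)) ⊜ (Κ 1# :+ (x :+ y))) refl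

  ι-+ : ∀ x y → ι (x ℤ.+ y) ≈ ι x + ι y
  ι-+ (+ m)    (+ k)    = ιℕ-+ m k
  ι-+ (+ m)    -[1+ k ] = ι-⊖ m (suc k)
  ι-+ -[1+ m ] (+ k)    = trans (ι-⊖ k (suc m)) (+-comm _ _)
  ι-+ -[1+ m ] -[1+ k ] =
    trans (-‿cong (trans (+-congˡ (+-congˡ (ιℕ-+ m k))) (regroup _ _))) (sym (-‿+-comm _ _))
    where
    regroup : ∀ x y → 1# + (1# + (x + y)) ≈ (1# + x) + (1# + y)
    regroup = solve 2 (λ x y → (Κ 1# :+ (Κ 1# :+ (x :+ y))) ⊜ ((Κ 1# :+ x) :+ (Κ 1# :+ y))) refl

  ιSign : Sign → Carrier
  ιSign Sign.+ = 1#
  ιSign Sign.- = - 1#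

  ιSign-* : ∀ s t → ιSign (s Sign.* t) ≈ ιSign s * ιSign t
  ιSign-* Sign.+ t      = sym (*-identityˡ _)
  ιSign-* Sign.- Sign.+ = sym (*-identityʳ _)
  ιSign-* Sign.- Sign.- = sym (trans (-1*x≈-x _) (-‿involutive 1#))

  ι-◃ : ∀ s k → ι (s ℤ.◃ k) ≈ ιSign s * ιℕ k
  ι-◃ s      zero    = sym (zeroʳ _)
  ι-◃ Sign.+ (suc k) = sym (*-identityˡ _)
  ι-◃ Sign.- (suc k) = sym (-1*x≈-x _)

  ι≈sign*abs : ∀ x → ι x ≈ ιSign (ℤ.sign x) * ιℕ ℤ.∣ x ∣
  ι≈sign*abs (+ k)    = sym (*-identityˡ _)
  ι≈sign*abs -[1+ k ] = sym (-1*x≈-x _)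

  ι-* : ∀ x y → ι (x ℤ.* y) ≈ ι x * ι y
  ι-* x y = begin
    ι (ℤ.sign x Sign.* ℤ.sign y ℤ.◃ ℤ.∣ x ∣ ℕ.* ℤ.∣ y ∣)
      ≈⟨ ι-◃ (ℤ.sign x Sign.* ℤ.sign y) (ℤ.∣ x ∣ ℕ.* ℤ.∣ y ∣) ⟩
    ιSign (ℤ.sign x Sign.* ℤ.sign y) * ιℕ (ℤ.∣ x ∣ ℕ.* ℤ.∣ y ∣)
      ≈⟨ *-cong (ιSign-* (ℤ.sign x) (ℤ.sign y)) (ιℕ-* ℤ.∣ x ∣ ℤ.∣ y ∣) ⟩
    (ιSign (ℤ.sign x) * ιSign (ℤ.sign y)) * (ιℕ ℤ.∣ x ∣ * ιℕ ℤ.∣ y ∣)   ≈⟨ interchange _ _ _ _ ⟩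
    (ιSign (ℤ.sign x) * ιℕ ℤ.∣ x ∣) * (ιSign (ℤ.sign y) * ιℕ ℤ.∣ y ∣)
      ≈⟨ *-cong (ι≈sign*abs x) (ι≈sign*abs y) ⟨
    ι x * ι y ∎
    where
    open SetoidReasoning setoid
    interchange : ∀ a b c d → (a * b) * (c * d) ≈ (a * c) * (b * d)
    interchange = solve 4 (λ a b c d → ((a :* b) :* (c :* d)) ⊜ ((a :* c) :* (b :* d))) refl

  ι-dotℤ : ∀ {m} (l v : Fin m → ℤ) → ι (dotℤ l v) ≈ sumF (λ k → ι (l k) * ι (v k))
  ι-dotℤ {zero}  l v = refl
  ι-dotℤ {suc m} l v = trans (ι-+ (l zero ℤ.* v zero) _)
    (+-cong (ι-* (l zero) (v zero)) (ι-dotℤ (λ k → l (suc k)) (λ k → v (suc k))))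

  dotℤ≡1⇒e*e≈1 : dotℤ e*⁰ e⁰ ≡ + 1 → sumF (λ k → e* k * e k) ≈ 1#
  dotℤ≡1⇒e*e≈1 e*e≡1 =
    trans (sym (ι-dotℤ e*⁰ e⁰)) (trans (reflexive (≡.cong ι e*e≡1)) (+-identityʳ 1#))

  ⊝_ : Mat → Mat
  (⊝ A) i j = - A i j

  ⊗-cong : ∀ {A A′ B B′} → A ≈M A′ → B ≈M B′ → A ⊗ B ≈M A′ ⊗ B′
  ⊗-cong A≈A′ B≈B′ i j = sumF-cong (λ k → *-cong (A≈A′ i k) (B≈B′ k j))

  ⊗-assoc : ∀ A B C → (A ⊗ B) ⊗ C ≈M A ⊗ (B ⊗ C)
  ⊗-assoc A B C i j = begin
    sumF (λ k → sumF (λ m → A i m * B m k) * C k j)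
      ≈⟨ sumF-cong (λ k → *-distribʳ-sumF (C k j) (λ m → A i m * B m k)) ⟩
    sumF (λ k → sumF (λ m → A i m * B m k * C k j))
      ≈⟨ sumF-comm (λ k m → A i m * B m k * C k j) ⟩
    sumF (λ m → sumF (λ k → A i m * B m k * C k j))
      ≈⟨ sumF-cong (λ m → trans (sumF-cong {n} (λ k → *-assoc _ _ _))
                                (sym (*-distribˡ-sumF (A i m) (λ k → B m k * C k j)))) ⟩
    sumF (λ m → A i m * sumF (λ k → B m k * C k j)) ∎
    where open SetoidReasoning setoid

  ⊗-identityˡ : ∀ A → 𝟙 ⊗ A ≈M A
  ⊗-identityˡ A i j = sumF-𝟙ˡ i (λ k → A k j)

  ⊗-identityʳ : ∀ A → A ⊗ 𝟙 ≈M A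
  ⊗-identityʳ A i j = sumF-𝟙ʳ j (A i)

  ⊗-distribˡ-⊕ : ∀ A B C → A ⊗ (B ⊕ C) ≈M A ⊗ B ⊕ A ⊗ C
  ⊗-distribˡ-⊕ A B C i j =
    trans (sumF-cong (λ k → distribˡ (A i k) _ _))
          (sumF-distrib-+ (λ k → A i k * B k j) (λ k → A i k * C k j))

  ⊗-distribʳ-⊕ : ∀ A B C → (B ⊕ C) ⊗ A ≈M B ⊗ A ⊕ C ⊗ A
  ⊗-distribʳ-⊕ A B C i j =
    trans (sumF-cong (λ k → distribʳ (A k j) _ _))
          (sumF-distrib-+ (λ k → B i k * A k j) (λ k → C i k * A k j))

  matrixRing : Ring c ℓ
  matrixRing = record
    { Carrier = Mat ; _≈_ = _≈M_ ; _+_ = _⊕_ ; _*_ = _⊗_ ; -_ = ⊝_ ; 0# = 0M ; 1# = 𝟙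
    ; isRing = record
      { +-isAbelianGroup = P.isAbelianGroup (P.isAbelianGroup +-isAbelianGroup)
      ; *-cong = ⊗-cong
      ; *-assoc = ⊗-assoc
      ; *-identity = ⊗-identityˡ , ⊗-identityʳ
      ; distrib = ⊗-distribˡ-⊕ , ⊗-distribʳ-⊕
      }
    }
    where module P = Pointwise (Fin n)

  module M where
    open Ring matrixRing public
    open RingWithoutOneProperties ringWithoutOne public

  •𝟙-⊗ : ∀ r A → (r • 𝟙) ⊗ A ≈M r • A
  •𝟙-⊗ r A i j = trans (sumF-cong (λ k → rotate r (𝟙 i k) (A k j))) (sumF-𝟙ˡ i (λ k → r * A k j))
    where
    rotate : ∀ x y z → x * y * z ≈ y * (x * z)
    rotate x y z = trans (*-congʳ (*-comm x y)) (*-assoc y x z)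

  ⊗-•𝟙 : ∀ r A → A ⊗ (r • 𝟙) ≈M r • A
  ⊗-•𝟙 r A i j = trans (sumF-cong (λ k → rotate (A i k) r (𝟙 k j))) (sumF-𝟙ʳ j (λ k → r * A i k))
    where
    rotate : ∀ x y z → x * (y * z) ≈ y * x * z
    rotate x y z = trans (sym (*-assoc x y z)) (*-congʳ (*-comm x y))

  open SetoidReasoning M.setoid

  ⊖-≈0 : ∀ {A B} → B ≈M 0M → A ⊖ B ≈M A
  ⊖-≈0 {A} B≈0 = M.trans (M.+-congˡ (M.trans (M.-‿cong B≈0) M.-0#≈0#)) (M.+-identityʳ A)

  ⊕-≈0ˡ : ∀ {A X} → A ≈M 0M → A ⊕ X ≈M X
  ⊕-≈0ˡ {X = X} A≈0 = M.trans (M.+-congʳ A≈0) (M.+-identityˡ X)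

  ⊕-≈0ʳ : ∀ {A X} → A ≈M 0M → X ⊕ A ≈M X
  ⊕-≈0ʳ {X = X} A≈0 = M.trans (M.+-congˡ A≈0) (M.+-identityʳ X)

  ⊗≈0⇒⊗⊗≈0 : ∀ {A B} → A ⊗ B ≈M 0M → ∀ X → A ⊗ (B ⊗ X) ≈M 0M
  ⊗≈0⇒⊗⊗≈0 {A} {B} AB≈0 X = M.trans (M.sym (M.*-assoc A B X)) (M.trans (M.*-congʳ AB≈0) (M.zeroˡ X))

  ⊗-distribˡ-⊕₄ : ∀ X A B C D → X ⊗ (A ⊕ B ⊕ C ⊕ D) ≈M X ⊗ A ⊕ X ⊗ B ⊕ X ⊗ C ⊕ X ⊗ D
  ⊗-distribˡ-⊕₄ X A B C D = M.trans (M.distribˡ X _ D)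
    (M.+-congʳ (M.trans (M.distribˡ X _ C) (M.+-congʳ (M.distribˡ X A B))))

  ⊗-distribʳ-⊕₄ : ∀ X A B C D → (A ⊕ B ⊕ C ⊕ D) ⊗ X ≈M A ⊗ X ⊕ B ⊗ X ⊕ C ⊗ X ⊕ D ⊗ X
  ⊗-distribʳ-⊕₄ X A B C D = M.trans (M.distribʳ X _ D)
    (M.+-congʳ (M.trans (M.distribʳ X _ C) (M.+-congʳ (M.distribʳ X A B))))


  Commute-sym : ∀ {A B} → Commute A B → Commute B A
  Commute-sym = M.sym

  Commute-0M : ∀ {T} → Commute 0M T
  Commute-0M {T} = M.trans (M.zeroˡ T) (M.sym (M.zeroʳ T))

  Commute-•𝟙 : ∀ r {T} → Commute (r • 𝟙) T
  Commute-•𝟙 r {T} = M.trans (•𝟙-⊗ r T) (M.sym (⊗-•𝟙 r T))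

  Commute-⊕ : ∀ {A B T} → Commute A T → Commute B T → Commute (A ⊕ B) T
  Commute-⊕ {A} {B} {T} AT BT = begin
    (A ⊕ B) ⊗ T      ≈⟨ M.distribʳ T A B ⟩
    A ⊗ T ⊕ B ⊗ T    ≈⟨ M.+-cong AT BT ⟩
    T ⊗ A ⊕ T ⊗ B    ≈⟨ M.distribˡ T A B ⟨
    T ⊗ (A ⊕ B)      ∎

  Commute-⊖ : ∀ {A B T} → Commute A T → Commute B T → Commute (A ⊖ B) T
  Commute-⊖ {A} {B} {T} AT BT = begin
    (A ⊖ B) ⊗ T      ≈⟨ M.[y-z]x≈yx-zx T A B ⟩
    A ⊗ T ⊖ B ⊗ T    ≈⟨ M.+-cong AT (M.-‿cong BT) ⟩
    T ⊗ A ⊖ T ⊗ B    ≈⟨ M.x[y-z]≈xy-xz T A B ⟨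
    T ⊗ (A ⊖ B)      ∎

  Commute-⊗ : ∀ {A B T} → Commute A T → Commute B T → Commute (A ⊗ B) T
  Commute-⊗ {A} {B} {T} AT BT = begin
    (A ⊗ B) ⊗ T      ≈⟨ M.*-assoc A B T ⟩
    A ⊗ (B ⊗ T)      ≈⟨ M.*-congˡ BT ⟩
    A ⊗ (T ⊗ B)      ≈⟨ M.*-assoc A T B ⟨
    (A ⊗ T) ⊗ B      ≈⟨ M.*-congʳ AT ⟩
    (T ⊗ A) ⊗ B      ≈⟨ M.*-assoc T A B ⟩
    T ⊗ (A ⊗ B)      ∎

  Commute-polyM : ∀ p {T X} → Commute T X → Commute (polyM p T) X
  Commute-polyM []      TX = Commute-0M
  Commute-polyM (r ∷ p) TX = Commute-⊕ (Commute-•𝟙 r) (Commute-⊗ TX (Commute-polyM p TX))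

  polyM-commute : ∀ p q {T} → Commute (polyM p T) (polyM q T)
  polyM-commute p q = Commute-polyM p (Commute-sym (Commute-polyM q M.refl))

  -- Centralisers and cyclic vectors

  exchange : ∀ {A B} → Commute A B → ∀ Y → A ⊗ (B ⊗ Y) ≈M B ⊗ (A ⊗ Y)
  exchange {A} {B} AB Y = begin
    A ⊗ (B ⊗ Y)   ≈⟨ M.*-assoc A B Y ⟨
    (A ⊗ B) ⊗ Y   ≈⟨ M.*-congʳ AB ⟩
    (B ⊗ A) ⊗ Y   ≈⟨ M.*-assoc B A Y ⟩
    B ⊗ (A ⊗ Y)   ∎

  polyM-exchange : ∀ {u T} → Commute u T → ∀ q Y → u ⊗ (polyM q T ⊗ Y) ≈M polyM q T ⊗ (u ⊗ Y)
  polyM-exchange uT q = exchange (Commute-sym (Commute-polyM q (Commute-sym uT)))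

  -- app A v and capp l A are the entries of A ⊗ colM v and rowM l ⊗ A, definitionally.
  colM : Vec → Mat
  colM v i _ = v i

  rowM : Vec → Mat
  rowM l _ j = l j

  ≈M-by-columns : ∀ {A B} → (∀ v → A ⊗ colM v ≈M B ⊗ colM v) → A ≈M B
  ≈M-by-columns {A} {B} A≈B i j =
    trans (sym (sumF-𝟙ʳ j (A i))) (trans (A≈B (λ k → 𝟙 k j) i j) (sumF-𝟙ʳ j (B i)))

  ≈M-by-rows : ∀ {A B} → (∀ l → rowM l ⊗ A ≈M rowM l ⊗ B) → A ≈M B
  ≈M-by-rows {A} {B} A≈B i j =
    trans (sym (sumF-𝟙ˡ i (λ k → A k j))) (trans (A≈B (𝟙 i) i j) (sumF-𝟙ˡ i (λ k → B k j)))

  GeneratesImage : Mat → Vec → Mat → Set (c ⊔ ℓ)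
  GeneratesImage T b P = ∀ v → ∃ λ p → polyM p T ⊗ colM b ≈M P ⊗ colM v

  cyclic-column-faithful : ∀ {T b X} → GeneratesImage T b 𝟙 → Commute X T →
                           X ⊗ colM b ≈M 0M → X ≈M 0M
  cyclic-column-faithful {T} {b} {X} gen XT Xb≈0 = ≈M-by-columns λ v →
    let (p , pb≈v) = gen v in begin
    X ⊗ colM v                  ≈⟨ M.*-congˡ (M.sym (M.trans pb≈v (M.*-identityˡ (colM v)))) ⟩
    X ⊗ (polyM p T ⊗ colM b)    ≈⟨ polyM-exchange XT p (colM b) ⟩
    polyM p T ⊗ (X ⊗ colM b)    ≈⟨ M.*-congˡ Xb≈0 ⟩
    polyM p T ⊗ 0M              ≈⟨ M.zeroʳ _ ⟩
    0M                          ≈⟨ M.zeroˡ (colM v) ⟨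
    0M ⊗ colM v                 ∎

  cyclic-row-faithful : ∀ {T b X} → (∀ l → ∃ λ p → rowM b ⊗ polyM p T ≈M rowM l) →
                        Commute X T → rowM b ⊗ X ≈M 0M → X ≈M 0M
  cyclic-row-faithful {T} {b} {X} gen XT bX≈0 = ≈M-by-rows λ l →
    let (p , bp≈l) = gen l in begin
    rowM l ⊗ X                  ≈⟨ M.*-congʳ bp≈l ⟨
    (rowM b ⊗ polyM p T) ⊗ X    ≈⟨ M.*-assoc _ _ X ⟩
    rowM b ⊗ (polyM p T ⊗ X)    ≈⟨ M.*-congˡ (Commute-polyM p (Commute-sym XT)) ⟩
    rowM b ⊗ (X ⊗ polyM p T)    ≈⟨ M.*-assoc _ X _ ⟨
    (rowM b ⊗ X) ⊗ polyM p T    ≈⟨ M.*-congʳ bX≈0 ⟩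
    0M ⊗ polyM p T              ≈⟨ M.zeroˡ _ ⟩
    0M                          ≈⟨ M.zeroʳ (rowM l) ⟨
    rowM l ⊗ 0M                 ∎

  centralizer-commutative : ∀ {T b P u₁ u₂} → GeneratesImage T b P →
    Commute u₁ T → P ⊗ u₁ ≈M u₁ → u₁ ⊗ P ≈M u₁ →
    Commute u₂ T → P ⊗ u₂ ≈M u₂ → u₂ ⊗ P ≈M u₂ →
    Commute u₁ u₂
  centralizer-commutative {T} {b} {P} {u₁} {u₂} gen u₁T Pu₁ u₁P u₂T Pu₂ u₂P =
    ≈M-by-columns λ v → let (p , pb≈Pv) = gen v ; Q = polyM p T in begin
    (u₁ ⊗ u₂) ⊗ colM v          ≈⟨ M.*-congʳ (M.*-congˡ u₂P) ⟨
    (u₁ ⊗ (u₂ ⊗ P)) ⊗ colM v    ≈⟨ reassociate u₁ u₂ P (colM v) ⟩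
    u₁ ⊗ (u₂ ⊗ (P ⊗ colM v))    ≈⟨ M.*-congˡ (M.*-congˡ pb≈Pv) ⟨
    u₁ ⊗ (u₂ ⊗ (Q ⊗ B))         ≈⟨ M.*-congˡ (polyM-exchange u₂T p B) ⟩
    u₁ ⊗ (Q ⊗ (u₂ ⊗ B))         ≈⟨ polyM-exchange u₁T p (u₂ ⊗ B) ⟩
    Q ⊗ (u₁ ⊗ (u₂ ⊗ B))         ≈⟨ M.*-congˡ on-generator ⟩
    Q ⊗ (u₂ ⊗ (u₁ ⊗ B))         ≈⟨ polyM-exchange u₂T p (u₁ ⊗ B) ⟨
    u₂ ⊗ (Q ⊗ (u₁ ⊗ B))         ≈⟨ M.*-congˡ (polyM-exchange u₁T p B) ⟨
    u₂ ⊗ (u₁ ⊗ (Q ⊗ B))         ≈⟨ M.*-congˡ (M.*-congˡ pb≈Pv) ⟩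
    u₂ ⊗ (u₁ ⊗ (P ⊗ colM v))    ≈⟨ reassociate u₂ u₁ P (colM v) ⟨
    (u₂ ⊗ (u₁ ⊗ P)) ⊗ colM v    ≈⟨ M.*-congʳ (M.*-congˡ u₁P) ⟩
    (u₂ ⊗ u₁) ⊗ colM v          ∎
    where
    B = colM b

    reassociate : ∀ W X Y Z → (W ⊗ (X ⊗ Y)) ⊗ Z ≈M W ⊗ (X ⊗ (Y ⊗ Z))
    reassociate W X Y Z = M.trans (M.*-assoc W _ Z) (M.*-congˡ (M.*-assoc X Y Z))

    polynomial-on-generator : ∀ {u} → P ⊗ u ≈M u → ∃ λ q → u ⊗ B ≈M polyM q T ⊗ B
    polynomial-on-generator {u} Pu =
      let (q , qb≈Pub) = gen (app u b) in
      q , M.trans (M.trans (M.sym (M.*-congʳ Pu)) (M.*-assoc P u B)) (M.sym qb≈Pub)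

    on-generator : u₁ ⊗ (u₂ ⊗ B) ≈M u₂ ⊗ (u₁ ⊗ B)
    on-generator =
      let (q₁ , u₁b≈q₁b) = polynomial-on-generator Pu₁
          (q₂ , u₂b≈q₂b) = polynomial-on-generator Pu₂
          Q₁ = polyM q₁ T ; Q₂ = polyM q₂ T in begin
      u₁ ⊗ (u₂ ⊗ B)   ≈⟨ M.*-congˡ u₂b≈q₂b ⟩
      u₁ ⊗ (Q₂ ⊗ B)   ≈⟨ polyM-exchange u₁T q₂ B ⟩
      Q₂ ⊗ (u₁ ⊗ B)   ≈⟨ M.*-congˡ u₁b≈q₁b ⟩
      Q₂ ⊗ (Q₁ ⊗ B)   ≈⟨ exchange (polyM-commute q₂ q₁) B ⟩
      Q₁ ⊗ (Q₂ ⊗ B)   ≈⟨ M.*-congˡ u₂b≈q₂b ⟨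
      Q₁ ⊗ (u₂ ⊗ B)   ≈⟨ polyM-exchange u₂T q₁ B ⟨
      u₂ ⊗ (Q₁ ⊗ B)   ≈⟨ M.*-congˡ u₁b≈q₁b ⟨
      u₂ ⊗ (u₁ ⊗ B)   ∎

  E : Mat
  E = colM e

  E* : Mat
  E* = rowM e*

  InMH-⊗E : ∀ {u} → InMH u → u ⊗ E ≈M 0M
  InMH-⊗E (ue≈0 , _) i _ = ue≈0 i

  InMH-E*⊗ : ∀ {u} → InMH u → E* ⊗ u ≈M 0M
  InMH-E*⊗ (_ , e*u≈0) _ j = e*u≈0 j

  InMHτ-0M : ∀ {τ} → InMHτ τ 0M
  InMHτ-0M = ((λ i → M.zeroˡ E i i) , (λ j → M.zeroʳ E* j j)) , Commute-0M

  InMHτ-⊗ : ∀ {τ u₁ u₂} → InMHτ τ u₁ → InMHτ τ u₂ → InMHτ τ (u₁ ⊗ u₂)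
  InMHτ-⊗ {u₁ = u₁} {u₂} (u₁∈MH , u₁τH) (u₂∈MH , u₂τH) =
    ((λ i → u₁u₂e≈0 i i) , (λ j → ⊗≈0⇒⊗⊗≈0 (InMH-E*⊗ u₁∈MH) u₂ j j)) , Commute-⊗ u₁τH u₂τH
    where
    u₁u₂e≈0 : (u₁ ⊗ u₂) ⊗ E ≈M 0M
    u₁u₂e≈0 = M.trans (M.*-assoc u₁ u₂ E) (M.trans (M.*-congˡ (InMH-⊗E u₂∈MH)) (M.zeroʳ u₁))

  module _ {τ} (stable : Stable τ) where

    e-generates : GeneratesImage τ e 𝟙
    e-generates v = let (p , pe≈v) = proj₁ stable v in
      p , λ i j → trans (pe≈v i) (sym (⊗-identityˡ (colM v) i j))

    centralizer-annihilates-e⇒0 : ∀ {X} → Commute X τ → X ⊗ E ≈M 0M → X ≈M 0M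
    centralizer-annihilates-e⇒0 = cyclic-column-faithful e-generates

    E*-cancel : ∀ {X Y} → Commute X τ → Commute Y τ → E* ⊗ X ≈M E* ⊗ Y → X ≈M Y
    E*-cancel {X} {Y} Xτ Yτ e*X≈e*Y =
      M.x∙y⁻¹≈ε⇒x≈y X Y (cyclic-row-faithful cogenerates (Commute-⊖ Xτ Yτ)
        (M.trans (M.x[y-z]≈xy-xz E* X Y) (M.x≈y⇒x∙y⁻¹≈ε e*X≈e*Y)))
      where
      cogenerates : ∀ l → ∃ λ p → E* ⊗ polyM p τ ≈M rowM l
      cogenerates l = let (p , e*p≈l) = proj₂ stable l in p , λ _ j → e*p≈l j

    centralizer-commutative-τ : ∀ {X Y} → Commute X τ → Commute Y τ → Commute X Y
    centralizer-commutative-τ Xτ Yτ = centralizer-commutative e-generates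
      Xτ (M.*-identityˡ _) (M.*-identityʳ _) Yτ (M.*-identityˡ _) (M.*-identityʳ _)

  -- The projection 1_H

  O : Mat
  O = outer e e*

  ⊗-O : ∀ A i j → (A ⊗ O) i j ≈ (A ⊗ E) i j * e* j
  ⊗-O A i j = trans (sumF-cong (λ k → sym (*-assoc (A i k) (e k) (e* j))))
                    (sym (*-distribʳ-sumF (e* j) (λ k → A i k * e k)))

  O-⊗ : ∀ A i j → (O ⊗ A) i j ≈ e i * (E* ⊗ A) i j
  O-⊗ A i j = trans (sumF-cong (λ k → *-assoc (e i) (e* k) (A k j)))
                    (sym (*-distribˡ-sumF (e i) (λ k → e* k * A k j)))

  O-⊗-colM : ∀ w → O ⊗ colM w ≈M (sumF (λ k → e* k * w k) • 𝟙) ⊗ E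
  O-⊗-colM w i j = trans (O-⊗ (colM w) i j) (trans (*-comm _ _) (sym (•𝟙-⊗ _ E i j)))

  ⊗-1H : ∀ {u} → u ⊗ E ≈M 0M → u ⊗ 1H ≈M u
  ⊗-1H {u} uE≈0 = M.trans (M.x[y-z]≈xy-xz u 𝟙 O)
    (M.trans (M.+-congʳ (M.*-identityʳ u)) (⊖-≈0 uO≈0))
    where
    uO≈0 : u ⊗ O ≈M 0M
    uO≈0 i j = trans (⊗-O u i j) (trans (*-congʳ (uE≈0 i j)) (zeroˡ _))

  1H-⊗ : ∀ {u} → E* ⊗ u ≈M 0M → 1H ⊗ u ≈M u
  1H-⊗ {u} e*u≈0 = M.trans (M.[y-z]x≈yx-zx u 𝟙 O)
    (M.trans (M.+-congʳ (M.*-identityˡ u)) (⊖-≈0 Ou≈0))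
    where
    Ou≈0 : O ⊗ u ≈M 0M
    Ou≈0 i j = trans (O-⊗ u i j) (trans (*-congˡ (e*u≈0 i j)) (zeroʳ _))

  module _ (e*e≈1 : sumF (λ k → e* k * e k) ≈ 1#) where

    O⊗E : O ⊗ E ≈M E
    O⊗E i j = trans (O-⊗ E i j) (trans (*-congˡ e*e≈1) (*-identityʳ _))

    1H⊗E : 1H ⊗ E ≈M 0M
    1H⊗E = M.trans (M.[y-z]x≈yx-zx E 𝟙 O)
      (M.trans (M.+-cong (M.*-identityˡ E) (M.-‿cong O⊗E)) (M.-‿inverseʳ E))

    1H⊕O : 1H ⊕ O ≈M 𝟙
    1H⊕O = M.trans (M.+-assoc 𝟙 (⊝ O) O)
      (M.trans (M.+-congˡ (M.-‿inverseˡ O)) (M.+-identityʳ 𝟙))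

    module _ {τ} (stable : Stable τ) where

      τH⊗E : τ H ⊗ E ≈M 0M
      τH⊗E = M.trans (M.*-assoc (1H ⊗ τ) 1H E) (M.trans (M.*-congˡ 1H⊗E) (M.zeroʳ _))

      1H⊗τ-split : 1H ⊗ τ ≈M τ H ⊕ (1H ⊗ τ) ⊗ O
      1H⊗τ-split = begin
        1H ⊗ τ                      ≈⟨ M.*-identityʳ (1H ⊗ τ) ⟨
        (1H ⊗ τ) ⊗ 𝟙                ≈⟨ M.*-congˡ 1H⊕O ⟨
        (1H ⊗ τ) ⊗ (1H ⊕ O)         ≈⟨ M.distribˡ (1H ⊗ τ) 1H O ⟩
        τ H ⊕ (1H ⊗ τ) ⊗ O          ∎

      1H-polyM-e : ∀ p → ∃ λ q → 1H ⊗ (polyM p τ ⊗ E) ≈M polyM q (τ H) ⊗ (1H ⊗ (τ ⊗ E))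
      1H-polyM-e [] =
        [] , M.trans (M.*-congˡ (M.zeroˡ E)) (M.trans (M.zeroʳ 1H) (M.sym (M.zeroˡ _)))
      1H-polyM-e (r ∷ p) with 1H-polyM-e p
      ... | q , 1HPe≈QB = s ∷ q , (begin
        1H ⊗ ((r • 𝟙 ⊕ τ ⊗ P) ⊗ E)
          ≈⟨ M.trans (M.*-congˡ (M.distribʳ E (r • 𝟙) (τ ⊗ P))) (M.distribˡ 1H _ _) ⟩
        1H ⊗ ((r • 𝟙) ⊗ E) ⊕ 1H ⊗ ((τ ⊗ P) ⊗ E)
          ≈⟨ M.trans (⊕-≈0ˡ scalar-term≈0) (M.trans (M.*-congˡ (M.*-assoc τ P E))
                                                    (M.sym (M.*-assoc 1H τ (P ⊗ E)))) ⟩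
        (1H ⊗ τ) ⊗ (P ⊗ E)
          ≈⟨ M.*-congʳ 1H⊗τ-split ⟩
        (τ H ⊕ (1H ⊗ τ) ⊗ O) ⊗ (P ⊗ E)
          ≈⟨ M.distribʳ (P ⊗ E) (τ H) _ ⟩
        τ H ⊗ (P ⊗ E) ⊕ ((1H ⊗ τ) ⊗ O) ⊗ (P ⊗ E)
          ≈⟨ M.+-cong τH-term O-term ⟩
        τ H ⊗ (Q ⊗ B) ⊕ (s • 𝟙) ⊗ B
          ≈⟨ M.trans (M.+-congˡ (M.*-assoc (τ H) Q B)) (M.+-comm _ _) ⟨
        (s • 𝟙) ⊗ B ⊕ (τ H ⊗ Q) ⊗ B
          ≈⟨ M.distribʳ B (s • 𝟙) (τ H ⊗ Q) ⟨
        (s • 𝟙 ⊕ τ H ⊗ Q) ⊗ B ∎)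
        where
        P = polyM p τ
        Q = polyM q (τ H)
        B = 1H ⊗ (τ ⊗ E)
        s = sumF (λ k → e* k * app P e k)

        scalar-term≈0 : 1H ⊗ ((r • 𝟙) ⊗ E) ≈M 0M
        scalar-term≈0 = M.trans (exchange (Commute-sym (Commute-•𝟙 r)) E)
                                (M.trans (M.*-congˡ 1H⊗E) (M.zeroʳ _))

        τH-term : τ H ⊗ (P ⊗ E) ≈M τ H ⊗ (Q ⊗ B)
        τH-term = M.trans (M.sym (M.*-congʳ (⊗-1H τH⊗E)))
                          (M.trans (M.*-assoc (τ H) 1H (P ⊗ E)) (M.*-congˡ 1HPe≈QB))

        O-term : ((1H ⊗ τ) ⊗ O) ⊗ (P ⊗ E) ≈M (s • 𝟙) ⊗ B
        O-term = begin
          ((1H ⊗ τ) ⊗ O) ⊗ (P ⊗ E)      ≈⟨ M.*-assoc (1H ⊗ τ) O (P ⊗ E) ⟩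
          (1H ⊗ τ) ⊗ (O ⊗ (P ⊗ E))      ≈⟨ M.*-congˡ (O-⊗-colM (app P e)) ⟩
          (1H ⊗ τ) ⊗ ((s • 𝟙) ⊗ E)      ≈⟨ exchange (Commute-sym (Commute-•𝟙 s)) E ⟩
          (s • 𝟙) ⊗ ((1H ⊗ τ) ⊗ E)      ≈⟨ M.*-congˡ (M.*-assoc 1H τ E) ⟩
          (s • 𝟙) ⊗ B                   ∎

      1H-generates : GeneratesImage (τ H) (app 1H (app τ e)) 1H
      1H-generates v = let (p , pe≈v) = proj₁ stable v ; (q , 1HPe≈QB) = 1H-polyM-e p in
        q , M.trans (M.sym 1HPe≈QB) (M.*-congˡ (λ i _ → pe≈v i))

      MHτ-commutative : ∀ {u₁ u₂} → InMHτ τ u₁ → InMHτ τ u₂ → Commute u₁ u₂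
      MHτ-commutative (u₁∈MH , u₁τH) (u₂∈MH , u₂τH) = centralizer-commutative 1H-generates
        u₁τH (1H-⊗ (InMH-E*⊗ u₁∈MH)) (⊗-1H (InMH-⊗E u₁∈MH))
        u₂τH (1H-⊗ (InMH-E*⊗ u₂∈MH)) (⊗-1H (InMH-⊗E u₂∈MH))

  -- Matrices over R''

  ≈''-sym : ∀ {A B} → A ≈'' B → B ≈'' A
  ≈''-sym (p₀ , p₁ , p₂ , p₁₂) = M.sym p₀ , M.sym p₁ , M.sym p₂ , M.sym p₁₂

  ≈''-trans : ∀ {A B C} → A ≈'' B → B ≈'' C → A ≈'' C
  ≈''-trans (p₀ , p₁ , p₂ , p₁₂) (q₀ , q₁ , q₂ , q₁₂) =
    M.trans p₀ q₀ , M.trans p₁ q₁ , M.trans p₂ q₂ , M.trans p₁₂ q₁₂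

  ⊗''-const : ∀ Y T → Y ⊗'' const'' T ≈'' mk'' (m0 Y ⊗ T) (m1 Y ⊗ T) (m2 Y ⊗ T) (m12 Y ⊗ T)
  ⊗''-const (mk'' Y₀ Y₁ Y₂ Y₁₂) T =
    M.refl , ⊕-≈0ˡ (M.zeroʳ Y₀) , ⊕-≈0ˡ (M.zeroʳ Y₀) ,
    ⊕-≈0ˡ (M.trans (⊕-≈0ʳ (M.zeroʳ Y₂)) (M.trans (⊕-≈0ʳ (M.zeroʳ Y₁)) (M.zeroʳ Y₀)))

  const-⊗'' : ∀ T Y → const'' T ⊗'' Y ≈'' mk'' (T ⊗ m0 Y) (T ⊗ m1 Y) (T ⊗ m2 Y) (T ⊗ m12 Y)
  const-⊗'' T (mk'' Y₀ Y₁ Y₂ Y₁₂) =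
    M.refl , ⊕-≈0ʳ (M.zeroˡ Y₀) , ⊕-≈0ʳ (M.zeroˡ Y₀) ,
    M.trans (⊕-≈0ʳ (M.zeroˡ Y₀)) (M.trans (⊕-≈0ʳ (M.zeroˡ Y₁)) (⊕-≈0ʳ (M.zeroˡ Y₂)))

  Commute''-const⇒Commute : ∀ {Y T} → Commute'' Y (const'' T) →
    Commute (m0 Y) T × Commute (m1 Y) T × Commute (m2 Y) T × Commute (m12 Y) T
  Commute''-const⇒Commute {Y} {T} YT =
    ≈''-trans (≈''-sym (⊗''-const Y T)) (≈''-trans YT (const-⊗'' T Y))

  Commute⇒Commute''-const : ∀ {Y T} →
    Commute (m0 Y) T × Commute (m1 Y) T × Commute (m2 Y) T × Commute (m12 Y) T →
    Commute'' Y (const'' T)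
  Commute⇒Commute''-const {Y} {T} YᵢT =
    ≈''-trans (⊗''-const Y T) (≈''-trans YᵢT (≈''-sym (const-⊗'' T Y)))

  tangent : Mat → Mat → Mat''
  tangent u₁ u₂ = mk'' 𝟙 u₁ u₂ 0M

  -- (1 + x)⁻¹ = 1 − x + x² for x = ε₁u₁ + ε₂u₂
  tangent⁻¹ : Mat → Mat → Mat''
  tangent⁻¹ u₁ u₂ = mk'' 𝟙 (⊝ u₁) (⊝ u₂) (u₁ ⊗ u₂ ⊕ u₂ ⊗ u₁)

  tangent-inverseʳ : ∀ u₁ u₂ → tangent u₁ u₂ ⊗'' tangent⁻¹ u₁ u₂ ≈'' 𝟙''
  tangent-inverseʳ u₁ u₂ =
      M.*-identityˡ 𝟙
    , M.trans (M.+-cong (M.*-identityˡ _) (M.*-identityʳ u₁)) (M.-‿inverseˡ u₁)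
    , M.trans (M.+-cong (M.*-identityˡ _) (M.*-identityʳ u₂)) (M.-‿inverseˡ u₂)
    , (begin
      𝟙 ⊗ W ⊕ u₁ ⊗ (⊝ u₂) ⊕ u₂ ⊗ (⊝ u₁) ⊕ 0M ⊗ 𝟙
        ≈⟨ M.trans (⊕-≈0ʳ (M.zeroˡ 𝟙)) (M.+-cong (M.+-cong (M.*-identityˡ W)
             (M.sym (M.-‿distribʳ-* u₁ u₂))) (M.sym (M.-‿distribʳ-* u₂ u₁))) ⟩
      W ⊕ ⊝ (u₁ ⊗ u₂) ⊕ ⊝ (u₂ ⊗ u₁)
        ≈⟨ M.+-congʳ (M.xyx⁻¹≈y (u₁ ⊗ u₂) (u₂ ⊗ u₁)) ⟩
      u₂ ⊗ u₁ ⊕ ⊝ (u₂ ⊗ u₁)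
        ≈⟨ M.-‿inverseʳ (u₂ ⊗ u₁) ⟩
      0M ∎)
    where W = u₁ ⊗ u₂ ⊕ u₂ ⊗ u₁

  tangent-inverseˡ : ∀ u₁ u₂ → tangent⁻¹ u₁ u₂ ⊗'' tangent u₁ u₂ ≈'' 𝟙''
  tangent-inverseˡ u₁ u₂ =
      M.*-identityˡ 𝟙
    , M.trans (M.+-cong (M.*-identityˡ u₁) (M.*-identityʳ _)) (M.-‿inverseʳ u₁)
    , M.trans (M.+-cong (M.*-identityˡ u₂) (M.*-identityʳ _)) (M.-‿inverseʳ u₂)
    , (begin
      𝟙 ⊗ 0M ⊕ (⊝ u₁) ⊗ u₂ ⊕ (⊝ u₂) ⊗ u₁ ⊕ W ⊗ 𝟙
        ≈⟨ M.+-cong (M.+-cong (M.trans (⊕-≈0ˡ (M.zeroʳ 𝟙)) (M.sym (M.-‿distribˡ-* u₁ u₂)))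
                               (M.sym (M.-‿distribˡ-* u₂ u₁)))
                    (M.*-identityʳ W) ⟩
      ⊝ (u₁ ⊗ u₂) ⊕ ⊝ (u₂ ⊗ u₁) ⊕ W
        ≈⟨ M.+-congʳ (M.-‿+-comm (u₁ ⊗ u₂) (u₂ ⊗ u₁)) ⟩
      ⊝ W ⊕ W
        ≈⟨ M.-‿inverseˡ W ⟩
      0M ∎)
    where W = u₁ ⊗ u₂ ⊕ u₂ ⊗ u₁

  tangent-InHτ'' : ∀ {τ u₁ u₂} → InMHτ τ u₁ → InMHτ τ u₂ → InHτ'' τ (tangent u₁ u₂)
  tangent-InHτ'' {τ} {u₁} {u₂} ((u₁e≈0 , e*u₁≈0) , u₁τH) ((u₂e≈0 , e*u₂≈0) , u₂τH) =
      ( (tangent⁻¹ u₁ u₂ , tangent-inverseʳ u₁ u₂ , tangent-inverseˡ u₁ u₂)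
      , ((λ i → sumF-𝟙ˡ i e) , u₁e≈0 , u₂e≈0 , (λ i → M.zeroˡ E i i))
      , ((λ j → sumF-𝟙ʳ j e*) , e*u₁≈0 , e*u₂≈0 , (λ j → M.zeroʳ E* j j)) )
    , Commute⇒Commute''-const (M.trans (M.*-identityˡ _) (M.sym (M.*-identityʳ _))
                               , u₁τH , u₂τH , Commute-0M)

  -- The factorisation a y = h g

  module DoubleTangency {τ} (stable : Stable τ) {a a⁻¹} (inv : Inverse a a⁻¹) (aτ : Commute a τ)
                        where

    conj : Mat → Mat
    conj u = a ⊗ u ⊗ a⁻¹

    IsMu : Mat → Mat → Set ℓ
    IsMu u x = Commute x τ × capp e* x ≈V capp e* (conj u)

    cancel-a·a⁻¹ : ∀ X Y → (X ⊗ a) ⊗ (a⁻¹ ⊗ Y) ≈M X ⊗ Y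
    cancel-a·a⁻¹ X Y = begin
      (X ⊗ a) ⊗ (a⁻¹ ⊗ Y)   ≈⟨ M.*-assoc X a _ ⟩
      X ⊗ (a ⊗ (a⁻¹ ⊗ Y))   ≈⟨ M.*-congˡ (M.*-assoc a a⁻¹ Y) ⟨
      X ⊗ ((a ⊗ a⁻¹) ⊗ Y)   ≈⟨ M.*-congˡ (M.trans (M.*-congʳ (proj₁ inv)) (M.*-identityˡ Y)) ⟩
      X ⊗ Y                 ∎

    ⊗a⊗a⁻¹ : ∀ X → X ⊗ a ⊗ a⁻¹ ≈M X
    ⊗a⊗a⁻¹ X = M.trans (M.*-assoc X a a⁻¹) (M.trans (M.*-congˡ (proj₁ inv)) (M.*-identityʳ X))

    conj⊗a : ∀ u → conj u ⊗ a ≈M a ⊗ u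
    conj⊗a u = M.trans (M.*-assoc (a ⊗ u) a⁻¹ a) (M.trans (M.*-congˡ (proj₂ inv)) (M.*-identityʳ _))

    cancel-a⁻¹·a : ∀ X Y → (X ⊗ a⁻¹) ⊗ (a ⊗ Y) ≈M X ⊗ Y
    cancel-a⁻¹·a X Y = begin
      (X ⊗ a⁻¹) ⊗ (a ⊗ Y)   ≈⟨ M.*-assoc X a⁻¹ _ ⟩
      X ⊗ (a⁻¹ ⊗ (a ⊗ Y))   ≈⟨ M.*-congˡ (M.*-assoc a⁻¹ a Y) ⟨
      X ⊗ ((a⁻¹ ⊗ a) ⊗ Y)   ≈⟨ M.*-congˡ (M.trans (M.*-congʳ (proj₂ inv)) (M.*-identityˡ Y)) ⟩
      X ⊗ Y                 ∎

    conj-⊗ : ∀ u v → conj u ⊗ conj v ≈M conj (u ⊗ v)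
    conj-⊗ u v = begin
      (a ⊗ u ⊗ a⁻¹) ⊗ (a ⊗ v ⊗ a⁻¹)   ≈⟨ M.*-congˡ (M.*-assoc a v a⁻¹) ⟩
      (a ⊗ u ⊗ a⁻¹) ⊗ (a ⊗ (v ⊗ a⁻¹)) ≈⟨ cancel-a⁻¹·a (a ⊗ u) (v ⊗ a⁻¹) ⟩
      (a ⊗ u) ⊗ (v ⊗ a⁻¹)             ≈⟨ M.*-assoc (a ⊗ u) v a⁻¹ ⟨
      a ⊗ u ⊗ v ⊗ a⁻¹                 ≈⟨ M.*-congʳ (M.*-assoc a u v) ⟩
      a ⊗ (u ⊗ v) ⊗ a⁻¹               ∎

    first-order-factor : ∀ {u x g₁ h₁} → IsMu u x → Commute g₁ τ → E* ⊗ h₁ ≈M 0M →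
                         a ⊗ u ≈M g₁ ⊕ h₁ ⊗ a → g₁ ≈M x ⊗ a × h₁ ≈M conj u ⊖ x
    first-order-factor {u} {x} {g₁} {h₁} (xτ , e*x≈e*au) g₁τ e*h₁≈0 au≈g₁+h₁a = g₁≈xa , h₁≈conj-x
      where
      e*g₁≈e*xa : E* ⊗ g₁ ≈M E* ⊗ (x ⊗ a)
      e*g₁≈e*xa = begin
        E* ⊗ g₁                    ≈⟨ ⊕-≈0ʳ (⊗≈0⇒⊗⊗≈0 e*h₁≈0 a) ⟨
        E* ⊗ g₁ ⊕ E* ⊗ (h₁ ⊗ a)    ≈⟨ M.distribˡ E* g₁ (h₁ ⊗ a) ⟨
        E* ⊗ (g₁ ⊕ h₁ ⊗ a)         ≈⟨ M.*-congˡ (M.trans (M.sym au≈g₁+h₁a) (M.sym (conj⊗a u))) ⟩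
        E* ⊗ (conj u ⊗ a)          ≈⟨ M.*-assoc E* (conj u) a ⟨
        (E* ⊗ conj u) ⊗ a          ≈⟨ M.*-congʳ (λ _ j → sym (e*x≈e*au j)) ⟩
        (E* ⊗ x) ⊗ a               ≈⟨ M.*-assoc E* x a ⟩
        E* ⊗ (x ⊗ a)               ∎

      g₁≈xa : g₁ ≈M x ⊗ a
      g₁≈xa = E*-cancel stable g₁τ (Commute-⊗ xτ aτ) e*g₁≈e*xa

      h₁≈conj-x : h₁ ≈M conj u ⊖ x
      h₁≈conj-x = begin
        h₁                          ≈⟨ ⊗a⊗a⁻¹ h₁ ⟨
        h₁ ⊗ a ⊗ a⁻¹                ≈⟨ M.*-congʳ (M.xyx⁻¹≈y g₁ (h₁ ⊗ a)) ⟨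
        (g₁ ⊕ h₁ ⊗ a ⊖ g₁) ⊗ a⁻¹    ≈⟨ M.*-congʳ (M.+-cong (M.sym au≈g₁+h₁a) (M.-‿cong g₁≈xa)) ⟩
        (a ⊗ u ⊖ x ⊗ a) ⊗ a⁻¹       ≈⟨ M.[y-z]x≈yx-zx a⁻¹ (a ⊗ u) (x ⊗ a) ⟩
        conj u ⊖ x ⊗ a ⊗ a⁻¹        ≈⟨ M.+-congˡ (M.-‿cong (⊗a⊗a⁻¹ x)) ⟩
        conj u ⊖ x                  ∎

    -- The coefficients of a ⊗ tangent u₁ u₂ = h ⊗ g, with what is used of h ∈ H(R'')
    -- and g ∈ G_τ(R'').
    record Factorisation (u₁ u₂ : Mat) : Set (c ⊔ ℓ) where
      field
        h₀ h₁ h₂ h₁₂ g₀ g₁ g₂ g₁₂ : Mat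
        e*h₀ : E* ⊗ h₀ ≈M E*
        e*h₁ : E* ⊗ h₁ ≈M 0M
        e*h₂ : E* ⊗ h₂ ≈M 0M
        e*h₁₂ : E* ⊗ h₁₂ ≈M 0M
        h₁e : h₁ ⊗ E ≈M 0M
        h₂e : h₂ ⊗ E ≈M 0M
        h₁₂e : h₁₂ ⊗ E ≈M 0M
        g₀τ : Commute g₀ τ
        g₁τ : Commute g₁ τ
        g₂τ : Commute g₂ τ
        g₁₂τ : Commute g₁₂ τ
        ε⁰ : a ≈M h₀ ⊗ g₀
        ε¹ : a ⊗ u₁ ≈M h₀ ⊗ g₁ ⊕ h₁ ⊗ g₀
        ε² : a ⊗ u₂ ≈M h₀ ⊗ g₂ ⊕ h₂ ⊗ g₀
        ε¹² : h₀ ⊗ g₁₂ ⊕ h₁ ⊗ g₂ ⊕ h₂ ⊗ g₁ ⊕ h₁₂ ⊗ g₀ ≈M 0M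

    factorise : DoublyTangentialAt1 τ a → ∀ {u₁ u₂} → InMHτ τ u₁ → InMHτ τ u₂ → Factorisation u₁ u₂
    factorise DT {u₁} {u₂} u₁∈MHτ u₂∈MHτ
      with DT (tangent u₁ u₂) (tangent-InHτ'' u₁∈MHτ u₂∈MHτ) M.refl
    ... | _ , mk'' h₀ h₁ h₂ h₁₂ , mk'' g₀ g₁ g₂ g₁₂
            , (_ , (_ , h₁e , h₂e , h₁₂e) , (e*h₀ , e*h₁ , e*h₂ , e*h₁₂)) , _ , gτ , ay≈hg =
      let (g₀τ , g₁τ , g₂τ , g₁₂τ) = Commute''-const⇒Commute gτ
          (ε⁰ , ε¹ , ε² , ε¹²) = ≈''-trans (≈''-sym (const-⊗'' a (tangent u₁ u₂))) ay≈hg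
      in record
      { h₀ = h₀ ; h₁ = h₁ ; h₂ = h₂ ; h₁₂ = h₁₂ ; g₀ = g₀ ; g₁ = g₁ ; g₂ = g₂ ; g₁₂ = g₁₂
      ; e*h₀ = λ _ j → e*h₀ j ; e*h₁ = λ _ j → e*h₁ j ; e*h₂ = λ _ j → e*h₂ j ; e*h₁₂ = λ _ j → e*h₁₂ j
      ; h₁e = λ i _ → h₁e i ; h₂e = λ i _ → h₂e i ; h₁₂e = λ i _ → h₁₂e i
      ; g₀τ = g₀τ ; g₁τ = g₁τ ; g₂τ = g₂τ ; g₁₂τ = g₁₂τ
      ; ε⁰ = M.trans (M.sym (M.*-identityʳ a)) ε⁰ ; ε¹ = ε¹ ; ε² = ε²
      ; ε¹² = M.trans (M.sym ε¹²) (M.zeroʳ a)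
      }

    module FactorisationProperties {u₁ u₂} (F : Factorisation u₁ u₂) where
      open Factorisation F

      g₀≈a : g₀ ≈M a
      g₀≈a = E*-cancel stable g₀τ aτ (begin
        E* ⊗ g₀           ≈⟨ M.*-congʳ e*h₀ ⟨
        (E* ⊗ h₀) ⊗ g₀    ≈⟨ M.*-assoc E* h₀ g₀ ⟩
        E* ⊗ (h₀ ⊗ g₀)    ≈⟨ M.*-congˡ ε⁰ ⟨
        E* ⊗ a            ∎)

      h₀≈𝟙 : h₀ ≈M 𝟙
      h₀≈𝟙 = begin
        h₀               ≈⟨ ⊗a⊗a⁻¹ h₀ ⟨
        h₀ ⊗ a ⊗ a⁻¹     ≈⟨ M.*-congʳ (M.trans (M.*-congˡ (M.sym g₀≈a)) (M.sym ε⁰)) ⟩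
        a ⊗ a⁻¹          ≈⟨ proj₁ inv ⟩
        𝟙                ∎

      normalise-ε : ∀ {u g h} → a ⊗ u ≈M h₀ ⊗ g ⊕ h ⊗ g₀ → a ⊗ u ≈M g ⊕ h ⊗ a
      normalise-ε au≈ = M.trans au≈ (M.+-cong (M.trans (M.*-congʳ h₀≈𝟙) (M.*-identityˡ _))
                                              (M.*-congˡ g₀≈a))

      component₁ : ∀ {x₁} → IsMu u₁ x₁ → g₁ ≈M x₁ ⊗ a × h₁ ≈M conj u₁ ⊖ x₁
      component₁ μ₁ = first-order-factor μ₁ g₁τ e*h₁ (normalise-ε ε¹)

      component₂ : ∀ {x₂} → IsMu u₂ x₂ → g₂ ≈M x₂ ⊗ a × h₂ ≈M conj u₂ ⊖ x₂
      component₂ μ₂ = first-order-factor μ₂ g₂τ e*h₂ (normalise-ε ε²)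

      g₁₂≈0 : g₁₂ ≈M 0M
      g₁₂≈0 = E*-cancel stable g₁₂τ Commute-0M (begin
        E* ⊗ g₁₂
          ≈⟨ M.trans (M.sym (M.*-assoc E* h₀ g₁₂)) (M.*-congʳ e*h₀) ⟨
        E* ⊗ (h₀ ⊗ g₁₂)
          ≈⟨ M.trans (⊕-≈0ʳ (⊗≈0⇒⊗⊗≈0 e*h₁₂ g₀)) (M.trans (⊕-≈0ʳ (⊗≈0⇒⊗⊗≈0 e*h₂ g₁))
                                                       (⊕-≈0ʳ (⊗≈0⇒⊗⊗≈0 e*h₁ g₂))) ⟨
        E* ⊗ (h₀ ⊗ g₁₂) ⊕ E* ⊗ (h₁ ⊗ g₂) ⊕ E* ⊗ (h₂ ⊗ g₁) ⊕ E* ⊗ (h₁₂ ⊗ g₀)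
          ≈⟨ ⊗-distribˡ-⊕₄ E* _ _ _ _ ⟨
        E* ⊗ (h₀ ⊗ g₁₂ ⊕ h₁ ⊗ g₂ ⊕ h₂ ⊗ g₁ ⊕ h₁₂ ⊗ g₀)
          ≈⟨ M.*-congˡ ε¹² ⟩
        E* ⊗ 0M ∎)

      first-order : ∀ {x₁} → IsMu u₁ x₁ → conj u₁ ⊗ E ≈M x₁ ⊗ E
      first-order {x₁} μ₁ = M.x∙y⁻¹≈ε⇒x≈y _ _ (begin
        conj u₁ ⊗ E ⊖ x₁ ⊗ E    ≈⟨ M.[y-z]x≈yx-zx E (conj u₁) x₁ ⟨
        (conj u₁ ⊖ x₁) ⊗ E      ≈⟨ M.*-congʳ (proj₂ (component₁ μ₁)) ⟨
        h₁ ⊗ E                  ≈⟨ h₁e ⟩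
        0M                      ∎)

      second-order : ∀ {x₁ x₂} → IsMu u₁ x₁ → IsMu u₂ x₂ →
        (conj u₁ ⊖ x₁) ⊗ (x₂ ⊗ E) ⊕ (conj u₂ ⊖ x₂) ⊗ (x₁ ⊗ E) ≈M 0M
      second-order {x₁} {x₂} μ₁ μ₂ = begin
        (conj u₁ ⊖ x₁) ⊗ (x₂ ⊗ E) ⊕ (conj u₂ ⊖ x₂) ⊗ (x₁ ⊗ E)
          ≈⟨ M.trans (⊕-≈0ʳ last≈0) (M.trans (M.+-congʳ (⊕-≈0ˡ first≈0))
               (M.+-cong (cross-term (proj₂ (component₁ μ₁)) (proj₁ (component₂ μ₂)))
                         (cross-term (proj₂ (component₂ μ₂)) (proj₁ (component₁ μ₁))))) ⟨
        (h₀ ⊗ g₁₂) ⊗ Z ⊕ (h₁ ⊗ g₂) ⊗ Z ⊕ (h₂ ⊗ g₁) ⊗ Z ⊕ (h₁₂ ⊗ g₀) ⊗ Z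
          ≈⟨ ⊗-distribʳ-⊕₄ Z _ _ _ _ ⟨
        (h₀ ⊗ g₁₂ ⊕ h₁ ⊗ g₂ ⊕ h₂ ⊗ g₁ ⊕ h₁₂ ⊗ g₀) ⊗ Z
          ≈⟨ M.trans (M.*-congʳ ε¹²) (M.zeroˡ Z) ⟩
        0M ∎
        where
        Z = a⁻¹ ⊗ E

        cross-term : ∀ {h g u x y} → h ≈M conj u ⊖ x → g ≈M y ⊗ a →
                     (h ⊗ g) ⊗ Z ≈M (conj u ⊖ x) ⊗ (y ⊗ E)
        cross-term {h} {g} {y = y} h≈ g≈ =
          M.trans (M.*-assoc h g Z) (M.*-cong h≈ (M.trans (M.*-congʳ g≈) (cancel-a·a⁻¹ y E)))

        first≈0 : (h₀ ⊗ g₁₂) ⊗ Z ≈M 0M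
        first≈0 = M.trans (M.*-congʳ (M.trans (M.*-congˡ g₁₂≈0) (M.zeroʳ h₀))) (M.zeroˡ Z)

        last≈0 : (h₁₂ ⊗ g₀) ⊗ Z ≈M 0M
        last≈0 = M.trans (M.*-congʳ (M.*-congˡ g₀≈a)) (M.trans (cancel-a·a⁻¹ h₁₂ E) h₁₂e)

    conj-⊗-⊗E : ∀ {u v y} → conj v ⊗ E ≈M y ⊗ E → conj u ⊗ (y ⊗ E) ≈M conj (u ⊗ v) ⊗ E
    conj-⊗-⊗E {u} {v} {y} conj-v≈y = begin
      conj u ⊗ (y ⊗ E)          ≈⟨ M.*-congˡ conj-v≈y ⟨
      conj u ⊗ (conj v ⊗ E)     ≈⟨ M.*-assoc (conj u) (conj v) E ⟨
      (conj u ⊗ conj v) ⊗ E     ≈⟨ M.*-congʳ (conj-⊗ u v) ⟩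
      conj (u ⊗ v) ⊗ E          ∎

    module _ (DT : DoublyTangentialAt1 τ a) where

      conj-⊗E : ∀ {u x} → InMHτ τ u → IsMu u x → conj u ⊗ E ≈M x ⊗ E
      conj-⊗E u∈MHτ = FactorisationProperties.first-order (factorise DT u∈MHτ InMHτ-0M)

      twice-defect⊗E≈0 : sumF (λ k → e* k * e k) ≈ 1# →
        ∀ {u₁ u₂ x₁ x₂ x₁₂} → InMHτ τ u₁ → InMHτ τ u₂ →
        IsMu u₁ x₁ → IsMu u₂ x₂ → IsMu (u₁ ⊗ u₂) x₁₂ →
        ((x₁₂ ⊖ x₁ ⊗ x₂) ⊕ (x₁₂ ⊖ x₁ ⊗ x₂)) ⊗ E ≈M 0M
      twice-defect⊗E≈0 e*e≈1 {u₁} {u₂} {x₁} {x₂} {x₁₂} u₁∈MHτ u₂∈MHτ μ₁ μ₂ μ₁₂ = begin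
        ((x₁₂ ⊖ x₁ ⊗ x₂) ⊕ (x₁₂ ⊖ x₁ ⊗ x₂)) ⊗ E
          ≈⟨ M.distribʳ E _ _ ⟩
        (x₁₂ ⊖ x₁ ⊗ x₂) ⊗ E ⊕ (x₁₂ ⊖ x₁ ⊗ x₂) ⊗ E
          ≈⟨ M.+-cong (expand x₁ x₂)
                      (M.trans (M.*-congʳ (M.+-congˡ (M.-‿cong x₁x₂≈x₂x₁))) (expand x₂ x₁)) ⟩
        (x₁₂ ⊗ E ⊖ x₁ ⊗ (x₂ ⊗ E)) ⊕ (x₁₂ ⊗ E ⊖ x₂ ⊗ (x₁ ⊗ E))
          ≈⟨ M.+-cong (expand-conj conj₁x₂≈x₁₂) (expand-conj conj₂x₁≈x₁₂) ⟨
        (conj u₁ ⊖ x₁) ⊗ (x₂ ⊗ E) ⊕ (conj u₂ ⊖ x₂) ⊗ (x₁ ⊗ E)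
          ≈⟨ FactorisationProperties.second-order (factorise DT u₁∈MHτ u₂∈MHτ) μ₁ μ₂ ⟩
        0M ∎
        where
        x₁x₂≈x₂x₁ : x₁ ⊗ x₂ ≈M x₂ ⊗ x₁
        x₁x₂≈x₂x₁ = centralizer-commutative-τ stable (proj₁ μ₁) (proj₁ μ₂)

        u₁u₂≈u₂u₁ : u₁ ⊗ u₂ ≈M u₂ ⊗ u₁
        u₁u₂≈u₂u₁ = MHτ-commutative e*e≈1 stable u₁∈MHτ u₂∈MHτ

        conj₁x₂≈x₁₂ : conj u₁ ⊗ (x₂ ⊗ E) ≈M x₁₂ ⊗ E
        conj₁x₂≈x₁₂ =
          M.trans (conj-⊗-⊗E (conj-⊗E u₂∈MHτ μ₂)) (conj-⊗E (InMHτ-⊗ u₁∈MHτ u₂∈MHτ) μ₁₂)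

        conj₂x₁≈x₁₂ : conj u₂ ⊗ (x₁ ⊗ E) ≈M x₁₂ ⊗ E
        conj₂x₁≈x₁₂ = M.trans (conj-⊗-⊗E (conj-⊗E u₁∈MHτ μ₁))
          (M.trans (M.*-congʳ (M.*-congʳ (M.*-congˡ (M.sym u₁u₂≈u₂u₁))))
                   (conj-⊗E (InMHτ-⊗ u₁∈MHτ u₂∈MHτ) μ₁₂))

        expand : ∀ y z → (x₁₂ ⊖ y ⊗ z) ⊗ E ≈M x₁₂ ⊗ E ⊖ y ⊗ (z ⊗ E)
        expand y z =
          M.trans (M.[y-z]x≈yx-zx E x₁₂ (y ⊗ z)) (M.+-congˡ (M.-‿cong (M.*-assoc y z E)))

        expand-conj : ∀ {u x y} → conj u ⊗ (y ⊗ E) ≈M x₁₂ ⊗ E →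
                      (conj u ⊖ x) ⊗ (y ⊗ E) ≈M x₁₂ ⊗ E ⊖ x ⊗ (y ⊗ E)
        expand-conj {u} {x} {y} conj-y≈x₁₂ =
          M.trans (M.[y-z]x≈yx-zx (y ⊗ E) (conj u) x) (M.+-congʳ conj-y≈x₁₂)

lemma5p17 : ∀ {c ℓ} (R : CommutativeRing c ℓ) (n : ℕ) (e⁰ e*⁰ : Fin n → ℤ)
    → dotℤ e*⁰ e⁰ ≡ + 1
    → let open Over R n e⁰ e*⁰ in
      (τ : Mat) → Stable τ
    → (a a⁻¹ : Mat) → Inverse a a⁻¹ → Commute a τ
    → DoublyTangentialAt1 τ a
    → (u₁ u₂ : Mat) → InMHτ τ u₁ → InMHτ τ u₂
    -- x₁ = μ(u₁), x₂ = μ(u₂), x₁₂ = μ(u₁u₂): the elements of M_τ(R) with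
    -- e* x = e* a u a⁻¹
    → (x₁ x₂ x₁₂ : Mat)
    → Commute x₁ τ → capp e* x₁ ≈V capp e* (a ⊗ u₁ ⊗ a⁻¹)
    → Commute x₂ τ → capp e* x₂ ≈V capp e* (a ⊗ u₂ ⊗ a⁻¹)
    → Commute x₁₂ τ → capp e* x₁₂ ≈V capp e* (a ⊗ (u₁ ⊗ u₂) ⊗ a⁻¹)
    → (x₁₂ ⊖ x₁ ⊗ x₂) ⊕ (x₁₂ ⊖ x₁ ⊗ x₂) ≈M 0M
lemma5p17 R n e⁰ e*⁰ e*e≡1 τ stable a a⁻¹ inv aτ DT u₁ u₂ u₁∈MHτ u₂∈MHτ
          x₁ x₂ x₁₂ x₁τ e*x₁ x₂τ e*x₂ x₁₂τ e*x₁₂ =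
  centralizer-annihilates-e⇒0 stable (Commute-⊕ defectτ defectτ)
    (twice-defect⊗E≈0 DT (dotℤ≡1⇒e*e≈1 e*e≡1) u₁∈MHτ u₂∈MHτ
                      (x₁τ , e*x₁) (x₂τ , e*x₂) (x₁₂τ , e*x₁₂))
  where
  open Over R n e⁰ e*⁰
  open OverProperties R n e⁰ e*⁰
  open DoubleTangency stable inv aτ

  defectτ : Commute (x₁₂ ⊖ x₁ ⊗ x₂) τ
  defectτ = Commute-⊖ x₁₂τ (Commute-⊗ x₁τ x₂τ)
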